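{- Let $\Phi$ be an irreducible crystallographic root system of rank two (i.e. $A_2$, $B_2$ or $G_2$) with simple system $\Delta$ and positive system $\Phi^+$. Let $V$ be the $3$-dimensional real Euclidean space with basis $\Delta\cup\{z\}$, $z$ a unit vector orthogonal to $\Delta$, identified with $V^*$, and let $H_\gamma^s$ denote the plane in $V$ defined by $\gamma-sz$ ($\gamma\in\Phi^+$, $s\in\mathbb{Z}$). Fix $k\in\mathbb{Z}_{>0}$. For $\alpha,\beta\in\Phi^+$ with $\alpha\ne\beta$ let $p_-:=H_\alpha^k\cap H_\beta^k$. Then: (1) if $\Delta=\{\alpha,\beta\}$, then $\{H_\gamma^s\mid\gamma\in\Phi^+,\ -k\le s\le k,\ p_-\subset H_\gamma^s\}=\{H_\alpha^k,H_\beta^k\}$; (2) if $\Delta\ne\{\alpha,\beta\}$, then there exists $\gamma\in\Phi^+$ such that $p_-\subset H_\gamma^0$. The same two statements hold with $p_-$ replaced by $p_+:=H_\alpha^{ -k}\cap H_\beta^{ -k}$ (and, in (1), $\{H_\alpha^k,H_\beta^k\}$ replaced by $\{H_\alpha^{ -k},H_\beta^{ -k}\}$).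
   Formalization: The space V is taken as ℚ³, with rational coordinates in the basis Δ∪{z}, rather than as a 3-dimensional real Euclidean space. -}

module Defs where

open import Data.Nat using (ℕ)
open import Data.Integer as ℤ using (ℤ; +_; -[1+_])
open import Data.Rational as ℚ using (ℚ; 0ℚ; 1ℚ; _/_)
open import Data.Product using (_×_; _,_; Σ; ∃; ∃-syntax)
open import Data.Sum using (_⊎_)
open import Data.List using (List; []; _∷_)
open import Data.List.Membership.Propositional using (_∈_)
open import Relation.Binary.PropositionalEquality using (_≡_)
open import Relation.Nullary using (¬_)

data RootType : Set where
  A₂ B₂ G₂ : RootType

-- An element of the root lattice, written by its integer coefficients
-- (c₁ , c₂) with respect to the simple system Δ = {α₁ , α₂}.
Root : Set
Root = ℤ × ℤ

α₁ α₂ : Root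
α₁ = (+ 1 , + 0)
α₂ = (+ 0 , + 1)

Δ : List Root
Δ = α₁ ∷ α₂ ∷ []

-- The positive system Φ⁺ (Bourbaki conventions; for B₂ and G₂, α₁ is short).
Φ⁺ : RootType → List Root
Φ⁺ A₂ = (+ 1 , + 0) ∷ (+ 0 , + 1) ∷ (+ 1 , + 1) ∷ []
Φ⁺ B₂ = (+ 1 , + 0) ∷ (+ 0 , + 1) ∷ (+ 1 , + 1) ∷ (+ 2 , + 1) ∷ []
Φ⁺ G₂ = (+ 1 , + 0) ∷ (+ 0 , + 1) ∷ (+ 1 , + 1) ∷ (+ 2 , + 1)
        ∷ (+ 3 , + 1) ∷ (+ 3 , + 2) ∷ []

-- The Euclidean space V, a vector being given by its coordinates
-- (x₁ , x₂ , x₃) with respect to the basis Δ ∪ {z} = (α₁ , α₂ , z).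
V : Set
V = ℚ × ℚ × ℚ

-- Inner products of the simple roots:
-- ( (α₁,α₁) , (α₁,α₂) , (α₂,α₂) ).
gram : RootType → ℚ × ℚ × ℚ
gram A₂ = (+ 2 / 1 , -[1+ 0 ] / 1 , + 2 / 1)
gram B₂ = (+ 1 / 1 , -[1+ 0 ] / 1 , + 2 / 1)
gram G₂ = (+ 2 / 1 , -[1+ 2 ] / 1 , + 6 / 1)

⟪_⟫ : RootType → V → V → ℚ
⟪ t ⟫ (u₁ , u₂ , u₃) (v₁ , v₂ , v₃) with gram t
... | (a , b , c) =
  a ℚ.* u₁ ℚ.* v₁ ℚ.+ b ℚ.* (u₁ ℚ.* v₂ ℚ.+ u₂ ℚ.* v₁)
  ℚ.+ c ℚ.* u₂ ℚ.* v₂ ℚ.+ u₃ ℚ.* v₃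

-- The vector γ - s z ∈ V (≅ V* via the inner product).
_-_z : Root → ℤ → V
(c₁ , c₂) - s z = (c₁ / 1 , c₂ / 1 , ℤ.- s / 1)

H : RootType → Root → ℤ → V → Set
H t γ s x = ⟪ t ⟫ (γ - s z) x ≡ 0ℚ

Subset : Set₁
Subset = V → Set

_⊆_ : Subset → Subset → Set
P ⊆ Q = ∀ x → P x → Q x

_≐_ : Subset → Subset → Set
P ≐ Q = (P ⊆ Q) × (Q ⊆ P)

_∩_ : Subset → Subset → Subset
(P ∩ Q) x = P x × Q x

-- The line H_α^c ∩ H_β^c  (c = k gives p₋, c = -k gives p₊).
p : RootType → Root → Root → ℤ → Subset
p t α β c = H t α c ∩ H t β c

IsΔ : Root → Root → Set
IsΔ α β = (α ≡ α₁ × β ≡ α₂) ⊎ (α ≡ α₂ × β ≡ α₁)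

InFamily : RootType → ℕ → Subset → Subset → Set
InFamily t k line S =
  ∃[ γ ] ∃[ s ] (γ ∈ Φ⁺ t × ℤ.- (+ k) ℤ.≤ s × s ℤ.≤ + k
                 × line ⊆ H t γ s × H t γ s ≐ S)

Claim1 : RootType → ℕ → Root → Root → ℤ → Set₁
Claim1 t k α β c =
  IsΔ α β →
    ((S : Subset) → InFamily t k (p t α β c) S →
        (S ≐ H t α c) ⊎ (S ≐ H t β c))
    × InFamily t k (p t α β c) (H t α c)
    × InFamily t k (p t α β c) (H t β c)

Claim2 : RootType → Root → Root → ℤ → Set
Claim2 t α β c =
  ¬ IsΔ α β → ∃[ γ ] (γ ∈ Φ⁺ t × p t α β c ⊆ H t γ (+ 0))

-- On p = H_α^c ∩ H_β^c (c = ±k) both α − c z and β − c z vanish, hence so does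
-- their difference α − β, which has no z-component.
--
-- (2) When {α, β} ≠ Δ, a finite check over Φ⁺ shows that α − β is parallel to a
-- positive root γ, so γ − 0 z vanishes on p as well.
--
-- (1) When {α, β} = Δ, the line p contains the point c ϖ + z, where ϖ ∈ span Δ
-- pairs to 1 with both simple roots.  There γ − s z takes the value ht(γ) c − s,
-- so a plane H_γ^s through p has s = ht(γ) c; since |s| ≤ k = |c|, this forces
-- ht(γ) = 1, i.e. γ is simple and s = c.

module Submission where

open import Defs
open import Data.Nat using (ℕ; _<_)
open import Data.Integer using (+_; -_)
open import Data.Product using (_×_)
open import Data.List.Membership.Propositional using (_∈_)
open import Relation.Binary.PropositionalEquality using (_≢_)

open import Data.Empty using (⊥-elim)
open import Data.Integer as ℤ using (ℤ; -[1+_]; +≤+; -≤+; ∣_∣)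
import Data.Integer.Properties as ℤP
import Data.Nat as ℕ
import Data.Nat.Properties as ℕP
open import Data.Rational as ℚ using (ℚ; 0ℚ; 1ℚ; _/_; toℚᵘ)
import Data.Rational.Properties as ℚP
open import Data.Rational.Unnormalised as ℚᵘ using (mkℚᵘ; *≡*) renaming (_≃_ to _≃ᵘ_)
import Data.Rational.Unnormalised.Properties as ℚᵘP
import Data.Rational.Solver as ℚSolver
open import Data.Product using (_,_; proj₁; proj₂; swap; ∃-syntax)
open import Data.Product.Properties using (≡-dec)
open import Data.Sum as Sum using (_⊎_; inj₁; inj₂)
open import Data.List.Relation.Unary.All using (All; all?; lookup)
open import Data.List.Relation.Unary.Any using (Any; any?; here; there)
open import Data.List.Membership.Propositional using (find)
open import Function using (_∘_; _⇔_; mk⇔; Equivalence)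
open import Relation.Nullary using (Dec; yes; no; ¬_)
open import Relation.Nullary.Decidable using (from-yes; _×-dec_; _⊎-dec_)
open import Relation.Binary.Definitions using (DecidableEquality)
open import Relation.Binary.PropositionalEquality
  using (_≡_; refl; sym; trans; cong; cong₂; subst; module ≡-Reasoning)

-- ι i is definitionally the coordinate i / 1 that Defs uses in γ - s z.
ι : ℤ → ℚ
ι i = i / 1

toℚᵘ-ι : ∀ i → toℚᵘ (ι i) ≃ᵘ mkℚᵘ i 0
toℚᵘ-ι i = ℚP.toℚᵘ-fromℚᵘ (mkℚᵘ i 0)

module _ where
  open ℚᵘP.≃-Reasoning

  ι-injective : ∀ {i j} → ι i ≡ ι j → i ≡ j
  ι-injective {i} {j} ιi≡ιj = cancel-denominators (begin
    mkℚᵘ i 0      ≈⟨ toℚᵘ-ι i ⟨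
    toℚᵘ (ι i)    ≡⟨ cong toℚᵘ ιi≡ιj ⟩
    toℚᵘ (ι j)    ≈⟨ toℚᵘ-ι j ⟩
    mkℚᵘ j 0      ∎)
    where
    cancel-denominators : mkℚᵘ i 0 ≃ᵘ mkℚᵘ j 0 → i ≡ j
    cancel-denominators (*≡* i*1≡j*1) =
      trans (sym (ℤP.*-identityʳ i)) (trans i*1≡j*1 (ℤP.*-identityʳ j))

  ι-homo-+ : ∀ i j → ι (i ℤ.+ j) ≡ ι i ℚ.+ ι j
  ι-homo-+ i j = ℚP.toℚᵘ-injective (begin
    toℚᵘ (ι (i ℤ.+ j))            ≈⟨ toℚᵘ-ι (i ℤ.+ j) ⟩
    mkℚᵘ (i ℤ.+ j) 0              ≈⟨ *≡* (cong (ℤ._* + 1) i+j≡i*1+j*1) ⟩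
    mkℚᵘ i 0 ℚᵘ.+ mkℚᵘ j 0        ≈⟨ ℚᵘP.+-cong (toℚᵘ-ι i) (toℚᵘ-ι j) ⟨
    toℚᵘ (ι i) ℚᵘ.+ toℚᵘ (ι j)    ≈⟨ ℚP.toℚᵘ-homo-+ (ι i) (ι j) ⟨
    toℚᵘ (ι i ℚ.+ ι j)            ∎)
    where
    i+j≡i*1+j*1 = cong₂ ℤ._+_ (sym (ℤP.*-identityʳ i)) (sym (ℤP.*-identityʳ j))

  ι-homo-* : ∀ i j → ι (i ℤ.* j) ≡ ι i ℚ.* ι j
  ι-homo-* i j = ℚP.toℚᵘ-injective (begin
    toℚᵘ (ι (i ℤ.* j))            ≈⟨ toℚᵘ-ι (i ℤ.* j) ⟩
    mkℚᵘ i 0 ℚᵘ.* mkℚᵘ j 0        ≈⟨ ℚᵘP.*-cong (toℚᵘ-ι i) (toℚᵘ-ι j) ⟨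
    toℚᵘ (ι i) ℚᵘ.* toℚᵘ (ι j)    ≈⟨ ℚP.toℚᵘ-homo-* (ι i) (ι j) ⟨
    toℚᵘ (ι i ℚ.* ι j)            ∎)

  ι-homo‿- : ∀ i → ι (- i) ≡ ℚ.- ι i
  ι-homo‿- i = ℚP.toℚᵘ-injective (begin
    toℚᵘ (ι (- i))                ≈⟨ toℚᵘ-ι (- i) ⟩
    ℚᵘ.- mkℚᵘ i 0                 ≈⟨ ℚᵘP.-‿cong (toℚᵘ-ι i) ⟨
    ℚᵘ.- toℚᵘ (ι i)               ≈⟨ ℚP.toℚᵘ-homo‿- (ι i) ⟨
    toℚᵘ (ℚ.- ι i)                ∎)

ι-homo-− : ∀ i j → ι (i ℤ.- j) ≡ ι i ℚ.- ι j
ι-homo-− i j = trans (ι-homo-+ i (- j)) (cong (ι i ℚ.+_) (ι-homo‿- j))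

*-cancelˡ-≡0 : ∀ {d y} → d ≢ 0ℚ → d ℚ.* y ≡ 0ℚ → y ≡ 0ℚ
*-cancelˡ-≡0 {d} {y} d≢0 dy≡0 = begin
  y                      ≡⟨ ℚP.*-identityˡ y ⟨
  1ℚ ℚ.* y               ≡⟨ cong (ℚ._* y) (ℚP.*-inverseˡ d) ⟨
  ℚ.1/ d ℚ.* d ℚ.* y     ≡⟨ ℚP.*-assoc (ℚ.1/ d) d y ⟩
  ℚ.1/ d ℚ.* (d ℚ.* y)   ≡⟨ cong (ℚ.1/ d ℚ.*_) dy≡0 ⟩
  ℚ.1/ d ℚ.* 0ℚ          ≡⟨ ℚP.*-zeroʳ (ℚ.1/ d) ⟩
  0ℚ                     ∎
  where
  open ≡-Reasoning
  instance
    d-nonZero : ℚ.NonZero d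
    d-nonZero = ℚ.≢-nonZero d≢0

module _ where
  open import Data.Rational using (_+_; _*_; _-_)
  open ≡-Reasoning

  collinear-kernel : ∀ {g₁ g₂ d₁ d₂ P₁ P₂} → g₁ * d₂ ≡ g₂ * d₁ → d₁ ≢ 0ℚ ⊎ d₂ ≢ 0ℚ →
    d₁ * P₁ + d₂ * P₂ ≡ 0ℚ → g₁ * P₁ + g₂ * P₂ ≡ 0ℚ
  collinear-kernel {g₁} {g₂} {d₁} {d₂} {P₁} {P₂} g∥d (inj₁ d₁≢0) dP≡0 =
    *-cancelˡ-≡0 d₁≢0 (begin
      d₁ * (g₁ * P₁ + g₂ * P₂)
        ≡⟨ rearrange g₁ g₂ d₁ d₂ P₁ P₂ ⟩
      g₁ * (d₁ * P₁ + d₂ * P₂) + (g₂ * d₁ - g₁ * d₂) * P₂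
        ≡⟨ cong₂ (λ u v → g₁ * u + (g₂ * d₁ - v) * P₂) dP≡0 g∥d ⟩
      g₁ * 0ℚ + (g₂ * d₁ - g₂ * d₁) * P₂
        ≡⟨ vanish g₁ (g₂ * d₁) P₂ ⟩
      0ℚ ∎)
    where
    open ℚSolver.+-*-Solver
    rearrange : ∀ g₁ g₂ d₁ d₂ P₁ P₂ →
      d₁ * (g₁ * P₁ + g₂ * P₂) ≡ g₁ * (d₁ * P₁ + d₂ * P₂) + (g₂ * d₁ - g₁ * d₂) * P₂
    rearrange = solve 6 (λ g₁ g₂ d₁ d₂ P₁ P₂ →
      d₁ :* (g₁ :* P₁ :+ g₂ :* P₂) := g₁ :* (d₁ :* P₁ :+ d₂ :* P₂) :+ (g₂ :* d₁ :- g₁ :* d₂) :* P₂)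
      refl
    vanish : ∀ g e P → g * 0ℚ + (e - e) * P ≡ 0ℚ
    vanish = solve 3 (λ g e P → g :* con 0ℚ :+ (e :- e) :* P := con 0ℚ) refl
  collinear-kernel {g₁} {g₂} {d₁} {d₂} {P₁} {P₂} g∥d (inj₂ d₂≢0) dP≡0 =
    trans (ℚP.+-comm (g₁ * P₁) (g₂ * P₂))
      (collinear-kernel {g₂} {g₁} {d₂} {d₁} {P₂} {P₁} (sym g∥d) (inj₁ d₂≢0)
        (trans (ℚP.+-comm (d₂ * P₂) (d₁ * P₁)) dP≡0))

⟪⟫-expand : ∀ t (γ : Root) s (x : V) → let (g₁ , g₂) = γ ; (_ , _ , x₃) = x in
  ⟪ t ⟫ (γ - s z) x
    ≡ ι g₁ ℚ.* ⟪ t ⟫ (α₁ - + 0 z) x ℚ.+ ι g₂ ℚ.* ⟪ t ⟫ (α₂ - + 0 z) x ℚ.+ ι (- s) ℚ.* x₃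
⟪⟫-expand t (g₁ , g₂) s (x₁ , x₂ , x₃) with gram t
... | (a , b , c) = solve 9 (λ a b c g₁ g₂ σ x₁ x₂ x₃ →
      a :* g₁ :* x₁ :+ b :* (g₁ :* x₂ :+ g₂ :* x₁) :+ c :* g₂ :* x₂ :+ σ :* x₃
      := g₁ :* (a :* one :* x₁ :+ b :* (one :* x₂ :+ zero :* x₁) :+ c :* zero :* x₂ :+ zero :* x₃)
         :+ g₂ :* (a :* zero :* x₁ :+ b :* (zero :* x₂ :+ one :* x₁) :+ c :* one :* x₂
                   :+ zero :* x₃)
         :+ σ :* x₃)
    refl a b c (ι g₁) (ι g₂) (ι (- s)) x₁ x₂ x₃
  where
  open ℚSolver.+-*-Solver
  one zero : ∀ {n} → Polynomial n
  one  = con 1ℚ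
  zero = con 0ℚ

⟪⟫-expand⁰ : ∀ t (γ : Root) x → let (g₁ , g₂) = γ in
  ⟪ t ⟫ (γ - + 0 z) x ≡ ι g₁ ℚ.* ⟪ t ⟫ (α₁ - + 0 z) x ℚ.+ ι g₂ ℚ.* ⟪ t ⟫ (α₂ - + 0 z) x
⟪⟫-expand⁰ t γ@(g₁ , g₂) x@(_ , _ , x₃) = trans (⟪⟫-expand t γ (+ 0) x)
  (trans (cong (Δ-part ℚ.+_) (ℚP.*-zeroˡ x₃)) (ℚP.+-identityʳ Δ-part))
  where Δ-part = ι g₁ ℚ.* ⟪ t ⟫ (α₁ - + 0 z) x ℚ.+ ι g₂ ℚ.* ⟪ t ⟫ (α₂ - + 0 z) x

⟪⟫-scale+z : ∀ t (u : V) q x₁ x₂ → let (_ , _ , u₃) = u in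
  ⟪ t ⟫ u (q ℚ.* x₁ , q ℚ.* x₂ , 1ℚ) ≡ q ℚ.* ⟪ t ⟫ u (x₁ , x₂ , 0ℚ) ℚ.+ u₃
⟪⟫-scale+z t (u₁ , u₂ , u₃) q x₁ x₂ with gram t
... | (a , b , c) = solve 9 (λ a b c u₁ u₂ u₃ q x₁ x₂ →
      a :* u₁ :* (q :* x₁) :+ b :* (u₁ :* (q :* x₂) :+ u₂ :* (q :* x₁)) :+ c :* u₂ :* (q :* x₂)
        :+ u₃ :* con 1ℚ
      := q :* (a :* u₁ :* x₁ :+ b :* (u₁ :* x₂ :+ u₂ :* x₁) :+ c :* u₂ :* x₂ :+ u₃ :* con 0ℚ) :+ u₃)
    refl a b c u₁ u₂ u₃ q x₁ x₂
  where open ℚSolver.+-*-Solver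

ht : Root → ℤ
ht (c₁ , c₂) = c₁ ℤ.+ c₂

ϖ : RootType → ℚ × ℚ
ϖ A₂ = (1ℚ , 1ℚ)
ϖ B₂ = (+ 3 / 1 , + 2 / 1)
ϖ G₂ = (+ 3 / 1 , + 5 / 3)

ϖ-pairs-to-1 : ∀ t → let (w₁ , w₂) = ϖ t in
  ⟪ t ⟫ (α₁ - + 0 z) (w₁ , w₂ , 0ℚ) ≡ 1ℚ × ⟪ t ⟫ (α₂ - + 0 z) (w₁ , w₂ , 0ℚ) ≡ 1ℚ
ϖ-pairs-to-1 A₂ = refl , refl
ϖ-pairs-to-1 B₂ = refl , refl
ϖ-pairs-to-1 G₂ = refl , refl

module _ where
  open import Data.Rational using (_+_; _*_)
  open ≡-Reasoning

  ⟪⟫-ϖ≡ht : ∀ t γ s → let (w₁ , w₂) = ϖ t in ⟪ t ⟫ (γ - s z) (w₁ , w₂ , 0ℚ) ≡ ι (ht γ)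
  ⟪⟫-ϖ≡ht t γ@(g₁ , g₂) s = begin
    ⟪ t ⟫ (γ - s z) ϖ₀
      ≡⟨ ⟪⟫-expand t γ s ϖ₀ ⟩
    ι g₁ * ⟪ t ⟫ (α₁ - + 0 z) ϖ₀ + ι g₂ * ⟪ t ⟫ (α₂ - + 0 z) ϖ₀ + ι (- s) * 0ℚ
      ≡⟨ cong₂ (λ u v → ι g₁ * u + ι g₂ * v + ι (- s) * 0ℚ) ⟨α₁,ϖ⟩≡1 ⟨α₂,ϖ⟩≡1 ⟩
    ι g₁ * 1ℚ + ι g₂ * 1ℚ + ι (- s) * 0ℚ
      ≡⟨ drop-units (ι g₁) (ι g₂) (ι (- s)) ⟩
    ι g₁ + ι g₂
      ≡⟨ ι-homo-+ g₁ g₂ ⟨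
    ι (ht γ) ∎
    where
    ϖ₀ = (proj₁ (ϖ t) , proj₂ (ϖ t) , 0ℚ)
    ⟨α₁,ϖ⟩≡1 = proj₁ (ϖ-pairs-to-1 t)
    ⟨α₂,ϖ⟩≡1 = proj₂ (ϖ-pairs-to-1 t)
    open ℚSolver.+-*-Solver
    drop-units : ∀ x y w → x * 1ℚ + y * 1ℚ + w * 0ℚ ≡ x + y
    drop-units = solve 3 (λ x y w → x :* con 1ℚ :+ y :* con 1ℚ :+ w :* con 0ℚ := x :+ y) refl

  linePoint : RootType → ℤ → V
  linePoint t c = let (w₁ , w₂) = ϖ t in (ι c * w₁ , ι c * w₂ , 1ℚ)

  ⟪⟫-linePoint : ∀ t γ s c → ⟪ t ⟫ (γ - s z) (linePoint t c) ≡ ι (ht γ ℤ.* c ℤ.- s)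
  ⟪⟫-linePoint t γ s c = begin
    ⟪ t ⟫ (γ - s z) (linePoint t c)
      ≡⟨ ⟪⟫-scale+z t (γ - s z) (ι c) w₁ w₂ ⟩
    ι c * ⟪ t ⟫ (γ - s z) (w₁ , w₂ , 0ℚ) + ι (- s)
      ≡⟨ cong (λ h → ι c * h + ι (- s)) (⟪⟫-ϖ≡ht t γ s) ⟩
    ι c * ι (ht γ) + ι (- s)
      ≡⟨ cong (_+ ι (- s)) (ℚP.*-comm (ι c) (ι (ht γ))) ⟩
    ι (ht γ) * ι c + ι (- s)
      ≡⟨ cong (_+ ι (- s)) (ι-homo-* (ht γ) c) ⟨
    ι (ht γ ℤ.* c) + ι (- s)
      ≡⟨ ι-homo-+ (ht γ ℤ.* c) (- s) ⟨
    ι (ht γ ℤ.* c ℤ.- s) ∎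
    where
    w₁ = proj₁ (ϖ t)
    w₂ = proj₂ (ϖ t)

H-linePoint⇔ : ∀ t γ s c → H t γ s (linePoint t c) ⇔ ht γ ℤ.* c ≡ s
H-linePoint⇔ t γ s c = mk⇔
  (λ h → ℤP.i-j≡0⇒i≡j _ _ (ι-injective {j = + 0} (trans (sym (⟪⟫-linePoint t γ s c)) h)))
  (λ hc≡s → trans (⟪⟫-linePoint t γ s c) (cong ι (trans
    (cong (λ v → ht γ ℤ.* c ℤ.- v) (sym hc≡s)) (ℤP.+-inverseʳ (ht γ ℤ.* c)))))

linePoint∈p : ∀ t c → p t α₁ α₂ c (linePoint t c)
linePoint∈p t c = Equivalence.from (H-linePoint⇔ t α₁ c c) (ℤP.*-identityˡ c)
                , Equivalence.from (H-linePoint⇔ t α₂ c c) (ℤP.*-identityˡ c)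

_≟ᴿ_ : DecidableEquality Root
_≟ᴿ_ = ≡-dec ℤ._≟_ ℤ._≟_

IsΔ? : ∀ α β → Dec (IsΔ α β)
IsΔ? α β = (α ≟ᴿ α₁ ×-dec β ≟ᴿ α₂) ⊎-dec (α ≟ᴿ α₂ ×-dec β ≟ᴿ α₁)

simple-roots-positive : ∀ t → α₁ ∈ Φ⁺ t × α₂ ∈ Φ⁺ t
simple-roots-positive A₂ = here refl , there (here refl)
simple-roots-positive B₂ = here refl , there (here refl)
simple-roots-positive G₂ = here refl , there (here refl)

SimpleOrTall : Root → Set
SimpleOrTall γ = γ ≡ α₁ ⊎ γ ≡ α₂ ⊎ + 2 ℤ.≤ ht γ

simpleOrTall? : ∀ γ → Dec (SimpleOrTall γ)
simpleOrTall? γ = γ ≟ᴿ α₁ ⊎-dec γ ≟ᴿ α₂ ⊎-dec + 2 ℤ.≤? ht γ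

positive-roots-simpleOrTall : ∀ t → All SimpleOrTall (Φ⁺ t)
positive-roots-simpleOrTall A₂ = from-yes (all? simpleOrTall? (Φ⁺ A₂))
positive-roots-simpleOrTall B₂ = from-yes (all? simpleOrTall? (Φ⁺ B₂))
positive-roots-simpleOrTall G₂ = from-yes (all? simpleOrTall? (Φ⁺ G₂))

∈[-n,n]⇔∣i∣≤n : ∀ {n} i → (- (+ n) ℤ.≤ i × i ℤ.≤ + n) ⇔ ∣ i ∣ ℕ.≤ n
∈[-n,n]⇔∣i∣≤n (+ m)    = mk⇔ (ℤP.drop‿+≤+ ∘ proj₂) (λ m≤n → ℤP.neg-≤-pos , +≤+ m≤n)
∈[-n,n]⇔∣i∣≤n -[1+ m ] =
  mk⇔ (ℤP.drop‿+≤+ ∘ ℤP.neg-cancel-≤ ∘ proj₁) (λ m<n → ℤP.neg-mono-≤ (+≤+ m<n) , -≤+)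

tall-multiple-exceeds : ∀ {k h c} → 0 < k → ∣ c ∣ ≡ k → + 2 ℤ.≤ h → k < ∣ h ℤ.* c ∣
tall-multiple-exceeds {k} {+ m} {c} 0<k ∣c∣≡k (+≤+ 1<m) = begin-strict
  k                <⟨ ℕP.m<m*n k m 1<m ⟩
  k ℕ.* m          ≡⟨ ℕP.*-comm k m ⟩
  m ℕ.* k          ≡⟨ cong (m ℕ.*_) ∣c∣≡k ⟨
  m ℕ.* ∣ c ∣      ≡⟨ ℤP.abs-* (+ m) c ⟨
  ∣ + m ℤ.* c ∣    ∎
  where
  open ℕP.≤-Reasoning
  instance
    k-nonZero : ℕ.NonZero k
    k-nonZero = ℕ.>-nonZero 0<k

H-in-family : ∀ t k c {line γ} → ∣ c ∣ ≡ k → γ ∈ Φ⁺ t → line ⊆ H t γ c →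
  InFamily t k line (H t γ c)
H-in-family t k c ∣c∣≡k γ∈Φ⁺ line⊆H =
  _ , c , γ∈Φ⁺ , proj₁ c∈[-k,k] , proj₂ c∈[-k,k] , line⊆H , (λ _ h → h) , (λ _ h → h)
  where c∈[-k,k] = Equivalence.from (∈[-n,n]⇔∣i∣≤n c) (ℕP.≤-reflexive ∣c∣≡k)

family-through-linePoint : ∀ t k c {line} → 0 < k → ∣ c ∣ ≡ k → line (linePoint t c) →
  (S : Subset) → InFamily t k line S → (S ≐ H t α₁ c) ⊎ (S ≐ H t α₂ c)
family-through-linePoint t k c 0<k ∣c∣≡k onLine S (γ , s , γ∈Φ⁺ , lo , hi , line⊆H , H≐S) =
  classify (lookup (positive-roots-simpleOrTall t) γ∈Φ⁺)
  where
  hc≡s : ht γ ℤ.* c ≡ s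
  hc≡s = Equivalence.to (H-linePoint⇔ t γ s c) (line⊆H _ onLine)
  simple : ∀ {δ} → γ ≡ δ → ht δ ≡ + 1 → S ≐ H t δ c
  simple refl ht≡1 = subst (λ s → S ≐ H t γ s) s≡c (swap H≐S)
    where s≡c = trans (sym hc≡s) (trans (cong (ℤ._* c) ht≡1) (ℤP.*-identityˡ c))
  classify : SimpleOrTall γ → (S ≐ H t α₁ c) ⊎ (S ≐ H t α₂ c)
  classify (inj₁ γ≡α₁)        = inj₁ (simple γ≡α₁ refl)
  classify (inj₂ (inj₁ γ≡α₂)) = inj₂ (simple γ≡α₂ refl)
  classify (inj₂ (inj₂ 2≤ht)) = ⊥-elim (ℕP.<⇒≱ (tall-multiple-exceeds 0<k ∣c∣≡k 2≤ht)
      (subst (ℕ._≤ k) (cong ∣_∣ (sym hc≡s)) (Equivalence.to (∈[-n,n]⇔∣i∣≤n s) (lo , hi))))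

claim1 : ∀ t k c {α β} → 0 < k → ∣ c ∣ ≡ k → Claim1 t k α β c
claim1 t k c 0<k ∣c∣≡k (inj₁ (refl , refl)) =
  family-through-linePoint t k c 0<k ∣c∣≡k (linePoint∈p t c) ,
  H-in-family t k c ∣c∣≡k (proj₁ (simple-roots-positive t)) (λ _ → proj₁) ,
  H-in-family t k c ∣c∣≡k (proj₂ (simple-roots-positive t)) (λ _ → proj₂)
claim1 t k c 0<k ∣c∣≡k (inj₂ (refl , refl)) =
  (λ S → Sum.swap ∘ family-through-linePoint t k c 0<k ∣c∣≡k (swap (linePoint∈p t c)) S) ,
  H-in-family t k c ∣c∣≡k (proj₂ (simple-roots-positive t)) (λ _ → proj₁) ,
  H-in-family t k c ∣c∣≡k (proj₁ (simple-roots-positive t)) (λ _ → proj₂)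

_−ᴿ_ : Root → Root → Root
(a₁ , a₂) −ᴿ (b₁ , b₂) = (a₁ ℤ.- b₁ , a₂ ℤ.- b₂)

Collinear : Root → Root → Set
Collinear (g₁ , g₂) (d₁ , d₂) = g₁ ℤ.* d₂ ≡ g₂ ℤ.* d₁

collinear? : ∀ γ δ → Dec (Collinear γ δ)
collinear? (g₁ , g₂) (d₁ , d₂) = g₁ ℤ.* d₂ ℤ.≟ g₂ ℤ.* d₁

−ᴿ-nonzero : ∀ {α β} → α ≢ β → let (d₁ , d₂) = α −ᴿ β in ι d₁ ≢ 0ℚ ⊎ ι d₂ ≢ 0ℚ
−ᴿ-nonzero {a₁ , a₂} {b₁ , b₂} α≢β with a₁ ℤ.- b₁ ℤ.≟ + 0 | a₂ ℤ.- b₂ ℤ.≟ + 0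
... | no d₁≢0  | _        = inj₁ (d₁≢0 ∘ ι-injective)
... | yes _    | no d₂≢0  = inj₂ (d₂≢0 ∘ ι-injective)
... | yes d₁≡0 | yes d₂≡0 =
  ⊥-elim (α≢β (cong₂ _,_ (ℤP.i-j≡0⇒i≡j a₁ b₁ d₁≡0) (ℤP.i-j≡0⇒i≡j a₂ b₂ d₂≡0)))

module _ where
  open import Data.Rational using (_+_; _*_; _-_)
  open ≡-Reasoning

  ⟪⟫-−ᴿ : ∀ t c α β x →
    ⟪ t ⟫ (α - c z) x - ⟪ t ⟫ (β - c z) x ≡ ⟪ t ⟫ ((α −ᴿ β) - + 0 z) x
  ⟪⟫-−ᴿ t c α@(a₁ , a₂) β@(b₁ , b₂) x@(_ , _ , x₃) = begin
    ⟪ t ⟫ (α - c z) x - ⟪ t ⟫ (β - c z) x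
      ≡⟨ cong₂ _-_ (⟪⟫-expand t α c x) (⟪⟫-expand t β c x) ⟩
    (ι a₁ * P₁ + ι a₂ * P₂ + ι (- c) * x₃) - (ι b₁ * P₁ + ι b₂ * P₂ + ι (- c) * x₃)
      ≡⟨ cancel-z (ι a₁) (ι a₂) (ι b₁) (ι b₂) P₁ P₂ (ι (- c) * x₃) ⟩
    (ι a₁ - ι b₁) * P₁ + (ι a₂ - ι b₂) * P₂
      ≡⟨ cong₂ (λ u v → u * P₁ + v * P₂) (ι-homo-− a₁ b₁) (ι-homo-− a₂ b₂) ⟨
    ι (a₁ ℤ.- b₁) * P₁ + ι (a₂ ℤ.- b₂) * P₂
      ≡⟨ ⟪⟫-expand⁰ t (α −ᴿ β) x ⟨
    ⟪ t ⟫ ((α −ᴿ β) - + 0 z) x ∎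
    where
    P₁ = ⟪ t ⟫ (α₁ - + 0 z) x
    P₂ = ⟪ t ⟫ (α₂ - + 0 z) x
    open ℚSolver.+-*-Solver
    cancel-z : ∀ a₁ a₂ b₁ b₂ P₁ P₂ w →
      (a₁ * P₁ + a₂ * P₂ + w) - (b₁ * P₁ + b₂ * P₂ + w) ≡ (a₁ - b₁) * P₁ + (a₂ - b₂) * P₂
    cancel-z = solve 7 (λ a₁ a₂ b₁ b₂ P₁ P₂ w →
      (a₁ :* P₁ :+ a₂ :* P₂ :+ w) :- (b₁ :* P₁ :+ b₂ :* P₂ :+ w)
      := (a₁ :- b₁) :* P₁ :+ (a₂ :- b₂) :* P₂) refl

  ⟪⟫-collinear : ∀ t {γ δ} x → Collinear γ δ → let (d₁ , d₂) = δ in ι d₁ ≢ 0ℚ ⊎ ι d₂ ≢ 0ℚ →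
    ⟪ t ⟫ (δ - + 0 z) x ≡ 0ℚ → ⟪ t ⟫ (γ - + 0 z) x ≡ 0ℚ
  ⟪⟫-collinear t {γ@(g₁ , g₂)} {δ@(d₁ , d₂)} x γ∥δ δ≢0 δx≡0 =
    trans (⟪⟫-expand⁰ t γ x)
      (collinear-kernel {ι g₁} {ι g₂} γ∥δ′ δ≢0 (trans (sym (⟪⟫-expand⁰ t δ x)) δx≡0))
    where
    γ∥δ′ : ι g₁ * ι d₂ ≡ ι g₂ * ι d₁
    γ∥δ′ = trans (sym (ι-homo-* g₁ d₂)) (trans (cong ι γ∥δ) (ι-homo-* g₂ d₁))

p⊆H⁰-of-collinear : ∀ t c {α β γ} → α ≢ β → Collinear γ (α −ᴿ β) → p t α β c ⊆ H t γ (+ 0)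
p⊆H⁰-of-collinear t c {α} {β} {γ} α≢β γ∥α−β x (αx≡0 , βx≡0) =
  ⟪⟫-collinear t {γ} {α −ᴿ β} x γ∥α−β (−ᴿ-nonzero α≢β)
    (trans (sym (⟪⟫-−ᴿ t c α β x)) (cong₂ ℚ._-_ αx≡0 βx≡0))

PairsHaveCollinearRoot : RootType → Set
PairsHaveCollinearRoot t = All (λ α → All (λ β →
  α ≡ β ⊎ IsΔ α β ⊎ Any (λ γ → Collinear γ (α −ᴿ β)) (Φ⁺ t)) (Φ⁺ t)) (Φ⁺ t)

pairsHaveCollinearRoot? : ∀ t → Dec (PairsHaveCollinearRoot t)
pairsHaveCollinearRoot? t = all? (λ α → all? (λ β →
  α ≟ᴿ β ⊎-dec IsΔ? α β ⊎-dec any? (λ γ → collinear? γ (α −ᴿ β)) (Φ⁺ t)) (Φ⁺ t)) (Φ⁺ t)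

pairsHaveCollinearRoot : ∀ t → PairsHaveCollinearRoot t
pairsHaveCollinearRoot A₂ = from-yes (pairsHaveCollinearRoot? A₂)
pairsHaveCollinearRoot B₂ = from-yes (pairsHaveCollinearRoot? B₂)
pairsHaveCollinearRoot G₂ = from-yes (pairsHaveCollinearRoot? G₂)

difference-collinear-with-root : ∀ t {α β} → α ∈ Φ⁺ t → β ∈ Φ⁺ t → α ≢ β → ¬ IsΔ α β →
  ∃[ γ ] (γ ∈ Φ⁺ t × Collinear γ (α −ᴿ β))
difference-collinear-with-root t α∈Φ⁺ β∈Φ⁺ α≢β ¬Δ
  with lookup (lookup (pairsHaveCollinearRoot t) α∈Φ⁺) β∈Φ⁺
... | inj₁ α≡β          = ⊥-elim (α≢β α≡β)
... | inj₂ (inj₁ Δ≡αβ)  = ⊥-elim (¬Δ Δ≡αβ)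
... | inj₂ (inj₂ γ∥α−β) = find γ∥α−β

claim2 : ∀ t c {α β} → α ∈ Φ⁺ t → β ∈ Φ⁺ t → α ≢ β → Claim2 t α β c
claim2 t c α∈Φ⁺ β∈Φ⁺ α≢β ¬Δ =
  let γ , γ∈Φ⁺ , γ∥α−β = difference-collinear-with-root t α∈Φ⁺ β∈Φ⁺ α≢β ¬Δ
  in γ , γ∈Φ⁺ , p⊆H⁰-of-collinear t c {γ = γ} α≢β γ∥α−β

lemma3p1 : (t : RootType) (k : ℕ) → 0 < k →
    (α β : Root) → α ∈ Φ⁺ t → β ∈ Φ⁺ t → α ≢ β →
    (Claim1 t k α β (+ k) × Claim2 t α β (+ k))
    × (Claim1 t k α β (- (+ k)) × Claim2 t α β (- (+ k)))
lemma3p1 t k 0<k α β α∈Φ⁺ β∈Φ⁺ α≢β =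
  (claim1 t k (+ k) 0<k refl , claim2 t (+ k) α∈Φ⁺ β∈Φ⁺ α≢β) ,
  (claim1 t k (- (+ k)) 0<k (ℤP.∣-i∣≡∣i∣ (+ k)) , claim2 t (- (+ k)) α∈Φ⁺ β∈Φ⁺ α≢β)
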